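{- Let $G$ be a directed graph without multiedges, $s,t$ nodes of $G$, and $B$ its $s$-$t$ bridge sequence. A substring $L=(e_1,\dots,e_{k})$ of $B$ is safe under the $s$-$t$ paths model if and only if each consecutive pair of edges of $L$ is adjacent, i.e. $\mathrm{head}(e_i)=\mathrm{tail}(e_{i+1})$ for all $1\le i<k$.
   Context: An $s$-$t$ bridge is an edge whose removal leaves no $s$-$t$ path; all $s$-$t$ bridges appear on every $s$-$t$ path in the same order, and $B$ is the sequence of $s$-$t$ bridges in this order. For an edge $e=(u,v)$, $\mathrm{tail}(e)=u$, $\mathrm{head}(e)=v$. A sequence of edges is safe under the $s$-$t$ paths model if it is a substring (contiguous) of the edge sequence of every $s$-$t$ path of $G$ (a path repeats no node). -}

module Defs where

open import Level using (0ℓ)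
open import Data.Nat using (ℕ)
open import Data.Fin using (Fin)
open import Data.Product using (Σ; _×_; _,_; proj₁; proj₂)
open import Data.List using (List; []; _∷_)
open import Data.List.Relation.Unary.Unique.Propositional using (Unique)
open import Data.List.Relation.Unary.Linked using (Linked)
open import Data.List.Relation.Binary.Infix.Heterogeneous using (Infix)
open import Data.List.Relation.Binary.Sublist.Propositional using (_⊆_)
open import Data.List.Membership.Propositional using (_∈_)
open import Relation.Binary.PropositionalEquality using (_≡_; _≢_)
open import Relation.Nullary using (¬_)

-- A directed graph on the node set Fin n without multiedges: an edge is
-- determined by its ordered pair of endpoints (u , v), and Adj u v says
-- that the edge (u , v) is present.
Edge : ℕ → Set
Edge n = Fin n × Fin n

tail : ∀ {n} → Edge n → Fin n
tail = proj₁

head : ∀ {n} → Edge n → Fin n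
head = proj₂

Graph : ℕ → Set₁
Graph n = Fin n → Fin n → Set

data Walk {n} (G : Graph n) : Fin n → Fin n → Set where
  []  : ∀ {u} → Walk G u u
  _∷_ : ∀ {u v w} → G u v → Walk G v w → Walk G u w

nodes : ∀ {n} {G : Graph n} {u w} → Walk G u w → List (Fin n)
nodes {u = u} []                  = u ∷ []
nodes {u = u} (_∷_ {u} {v} _ p)  = u ∷ nodes p

edges : ∀ {n} {G : Graph n} {u w} → Walk G u w → List (Edge n)
edges []                        = []
edges (_∷_ {u} {v} _ p)         = (u , v) ∷ edges p

Path : ∀ {n} → Graph n → Fin n → Fin n → Set
Path G s t = Σ (Walk G s t) (λ p → Unique (nodes p))

removeEdge : ∀ {n} → Graph n → Edge n → Graph n
removeEdge G e u v = G u v × (u , v) ≢ e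

IsBridge : ∀ {n} → Graph n → Fin n → Fin n → Edge n → Set
IsBridge G s t e = G (tail e) (head e) × ¬ Path (removeEdge G e) s t

IsBridgeSeq : ∀ {n} → Graph n → Fin n → Fin n → List (Edge n) → Set
IsBridgeSeq G s t B =
  (∀ e → (e ∈ B → IsBridge G s t e) × (IsBridge G s t e → e ∈ B)) ×
  (∀ (P : Path G s t) → B ⊆ edges (proj₁ P))

Substring : ∀ {n} → List (Edge n) → List (Edge n) → Set
Substring L xs = Infix _≡_ L xs

Safe : ∀ {n} → Graph n → Fin n → Fin n → List (Edge n) → Set
Safe G s t L = ∀ (P : Path G s t) → Substring L (edges (proj₁ P))

Adjacent : ∀ {n} → Edge n → Edge n → Set
Adjacent e f = head e ≡ tail f

AllAdjacent : ∀ {n} → List (Edge n) → Set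
AllAdjacent L = Linked Adjacent L

-- Necessity: consecutive edges of a walk are adjacent, and adjacency passes to
-- substrings. Sufficiency: the bridges occur in order on every s-t path, so L is
-- a subsequence of it; once the path has traversed e_i it stands at
-- head(e_i) = tail(e_(i+1)), and if e_(i+1) were traversed only later the path
-- would revisit that node, so the edges of L occur consecutively.
module Submission where

open import Defs
open import Data.Nat using (ℕ)
open import Data.Fin using (Fin)
open import Data.List using (List; []; _∷_)
open import Data.Product using (_,_; proj₁)
open import Data.Empty using (⊥-elim)
open import Function.Bundles using (_⇔_; mk⇔)
open import Relation.Binary.Core using (REL; Rel)
open import Relation.Binary.PropositionalEquality using (_≡_; refl; cong; sym)
open import Data.List.Relation.Unary.Linked as Linked using (Linked; []; [-]; _∷_)
open import Data.List.Relation.Unary.Any using (here; there)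
open import Data.List.Relation.Unary.All using (lookup)
open import Data.List.Relation.Unary.AllPairs using (_∷_)
open import Data.List.Relation.Unary.Unique.Propositional using (Unique)
open import Data.List.Relation.Binary.Prefix.Heterogeneous using (Prefix; []; _∷_)
open import Data.List.Relation.Binary.Infix.Heterogeneous using (Infix; here; there)
open import Data.List.Relation.Binary.Sublist.Heterogeneous
  using (Sublist; []; _∷_; _∷ʳ_; minimum)
open import Data.List.Relation.Binary.Sublist.Propositional using (_⊆_; ⊆-trans)
open import Data.List.Relation.Binary.Sublist.Propositional.Properties using (Any-resp-⊆)
open import Data.List.Membership.Propositional using (_∈_)

module _ {a b r} {A : Set a} {B : Set b} {R : REL A B r} where

  Prefix⇒Sublist : ∀ {as bs} → Prefix R as bs → Sublist R as bs
  Prefix⇒Sublist []       = minimum _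
  Prefix⇒Sublist (r ∷ rs) = r ∷ Prefix⇒Sublist rs

  Infix⇒Sublist : ∀ {as bs} → Infix R as bs → Sublist R as bs
  Infix⇒Sublist (here p)            = Prefix⇒Sublist p
  Infix⇒Sublist (there {b = b} inf) = b ∷ʳ Infix⇒Sublist inf

module _ {a r} {A : Set a} {R : Rel A r} where

  Linked-prefix : ∀ {as bs} → Prefix _≡_ as bs → Linked R bs → Linked R as
  Linked-prefix []                _        = []
  Linked-prefix (refl ∷ [])       _        = [-]
  Linked-prefix (refl ∷ refl ∷ p) (r ∷ rs) = r ∷ Linked-prefix (refl ∷ p) rs

  Linked-infix : ∀ {as bs} → Infix _≡_ as bs → Linked R bs → Linked R as
  Linked-infix (here p)    rs = Linked-prefix p rs
  Linked-infix (there inf) rs = Linked-infix inf (Linked.tail rs)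

module _ {n : ℕ} {G : Graph n} where

  edges-adjacent : ∀ {u w} (p : Walk G u w) → AllAdjacent (edges p)
  edges-adjacent []              = []
  edges-adjacent (_ ∷ [])        = [-]
  edges-adjacent (_ ∷ q@(_ ∷ _)) = refl ∷ edges-adjacent q

  tail∈nodes : ∀ {u w} (p : Walk G u w) {e} → e ∈ edges p → tail e ∈ nodes p
  tail∈nodes (_ ∷ _) (here e≡uv) = here (cong tail e≡uv)
  tail∈nodes (_ ∷ p) (there e∈p) = there (tail∈nodes p e∈p)

  -- An edge leaving u cannot be skipped: a simple walk never returns to u.
  adjacent-sublist⇒prefix : ∀ {u w} (p : Walk G u w) → Unique (nodes p) →
    ∀ {e L} → AllAdjacent (e ∷ L) → tail e ≡ u → e ∷ L ⊆ edges p →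
    Prefix _≡_ (e ∷ L) (edges p)
  adjacent-sublist⇒prefix (_ ∷ p) (u∉p ∷ _) _ e-from-u (_ ∷ʳ eL⊆p) =
    ⊥-elim (lookup u∉p (tail∈nodes p (Any-resp-⊆ eL⊆p (here refl))) (sym e-from-u))
  adjacent-sublist⇒prefix (_ ∷ p) _ {L = []} _ _ (e≡uv ∷ _) = e≡uv ∷ []
  adjacent-sublist⇒prefix (_ ∷ p) (_ ∷ p-unique) {L = _ ∷ _} (adj ∷ L-adj) _ (refl ∷ L⊆p) =
    refl ∷ adjacent-sublist⇒prefix p p-unique L-adj (sym adj) L⊆p

  adjacent-sublist⇒infix : ∀ {u w} (p : Walk G u w) → Unique (nodes p) →
    ∀ {L} → AllAdjacent L → L ⊆ edges p → Substring L (edges p)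
  adjacent-sublist⇒infix _       _              {[]}    _     _           = here []
  adjacent-sublist⇒infix (_ ∷ p) (_ ∷ p-unique) {_ ∷ _} L-adj (_ ∷ʳ L⊆p) =
    there (adjacent-sublist⇒infix p p-unique L-adj L⊆p)
  adjacent-sublist⇒infix q@(_ ∷ _) q-unique     {_ ∷ _} L-adj (refl ∷ L⊆p) =
    here (adjacent-sublist⇒prefix q q-unique L-adj refl (refl ∷ L⊆p))

  Safe⇒AllAdjacent : ∀ {s t L} → Path G s t → Safe G s t L → AllAdjacent L
  Safe⇒AllAdjacent (p , p-unique) safe =
    Linked-infix (safe (p , p-unique)) (edges-adjacent p)

  AllAdjacent⇒Safe : ∀ {s t L} → (∀ (P : Path G s t) → L ⊆ edges (proj₁ P)) →
    AllAdjacent L → Safe G s t L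
  AllAdjacent⇒Safe L⊆paths L-adj (p , p-unique) =
    adjacent-sublist⇒infix p p-unique L-adj (L⊆paths (p , p-unique))

theorem6 : (n : ℕ) (G : Graph n) (s t : Fin n) (B : List (Edge n)) →
           Path G s t → IsBridgeSeq G s t B →
           (L : List (Edge n)) → Substring L B →
           Safe G s t L ⇔ AllAdjacent L
theorem6 n G s t B P (_ , B⊆paths) L L⊆B = mk⇔
  (Safe⇒AllAdjacent P)
  (AllAdjacent⇒Safe (λ Q → ⊆-trans (Infix⇒Sublist L⊆B) (B⊆paths Q)))
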